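{- Let $\theta\in(0,1]$ and let $(b_n)_{n=1}^\infty$ be a weak greedy approximation of $\theta$. Let $(a_n)_{n=1}^\infty$ be defined by $a_n=G\left(\theta-\sum_{i=1}^{n-1}\frac{1}{b_i}\right)$ for all $n\geqslant1$. Then $(a_n)$ and $(b_n)$ are obtained from the WGAA applied to $\theta$ (i.e. from the $(t,\Lambda)$-WGAA for some real $t\geqslant1$ and some infinite $\Lambda\subset\mathbb{N}$) if and only if there exists $\varepsilon>0$ such that $a_{n+1}>(1+\varepsilon)a_n$ for infinitely many $n$.
   Context: For $x\in(0,1]$, $G(x)=\lfloor 1/x\rfloor+1$. A sequence of positive integers $(b_n)$ is a weak greedy approximation of $\theta\in(0,1]$ if $\sum_{n=1}^\infty 1/b_n=\theta$ and $G\left(\theta-\sum_{i=1}^{n-1}\frac1{b_i}\right)\leqslant b_n$ for all $n\geqslant1$. For real $t\geqslant1$ and infinite $\Lambda\subset\mathbb{N}$, the $(t,\Lambda)$-WGAA applied to $\theta$ produces sequences of positive integers $(a_n),(b_n)$ with $a_1=G(\theta)$, $a_{n+1}=G\left(\theta-\sum_{i=1}^n\frac1{b_i}\right)$, where at each step $b_n\geqslant a_n$ is chosen freely subject to the extra requirement $b_n\leqslant ta_n$ whenever $n\in\Lambda$.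
   Formalization: The parameter t of the $(t,\Lambda)$-WGAA and the constant ε in the jump condition are taken in ℚ rather than in the reals. -}

module Defs where

open import Data.Nat using (ℕ; zero; suc; _≥_; _∸_) renaming (_≤_ to _≤ℕ_)
open import Data.Integer using (+_)
open import Data.Rational using (ℚ; _/_; _+_; _*_; _<_; _≤_; 0ℚ; 1ℚ)
open import Data.Product using (Σ; ∃; _×_)

⟦_⟧ : ℕ → ℚ
⟦ n ⟧ = + n / 1

-- reciprocal 1/b of a natural number (only used for b ≥ 1; 1/0 := 0 is irrelevant)
recip : ℕ → ℚ
recip zero    = 0ℚ
recip (suc k) = + 1 / suc k

-- Sequences are indexed from 0: b 0 = b_1, b 1 = b_2, ...
-- tailSum b n m = 1/b_n + ... + 1/b_{n+m-1}  (finite partial sum of the tail from index n)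
tailSum : (ℕ → ℕ) → ℕ → ℕ → ℚ
tailSum b n zero    = 0ℚ
tailSum b n (suc m) = recip (b n) + tailSum b (suc n) m

partialSum : (ℕ → ℕ) → ℕ → ℚ
partialSum b m = tailSum b 0 m

-- The tail r_n = Σ_{i ≥ n} 1/b_i (a real number, the limit of tailSum b n m as m → ∞).
-- For a positive-term series with bounded partial sums:
--   r_n > q  iff  ∃ m, tailSum b n m > q
--   r_n ≤ q  iff  ∀ m, tailSum b n m ≤ q
-- G(x) = ⌊1/x⌋ + 1 = k  iff  k - 1 ≤ 1/x < k  iff  (k - 1) x ≤ 1 and 1 < k x.
-- GTail b n k  means  G(r_n) = k, i.e. G(θ - Σ_{i<n} 1/b_i) = k where θ = Σ_i 1/b_i.
GTail : (ℕ → ℕ) → ℕ → ℕ → Set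
GTail b n k = (∃ λ m → 1ℚ < ⟦ k ⟧ * tailSum b n m)
            × (∀ m → ⟦ k ∸ 1 ⟧ * tailSum b n m ≤ 1ℚ)

-- θ := Σ_{i} 1/b_i lies in (0,1] and the series converges:
-- positive integer terms with all partial sums ≤ 1 (then θ > 0 automatically).
SumsToThetaIn01 : (ℕ → ℕ) → Set
SumsToThetaIn01 b = (∀ n → 1 ≤ℕ b n) × (∀ m → partialSum b m ≤ 1ℚ)

WeakGreedy : (ℕ → ℕ) → Set
WeakGreedy b = SumsToThetaIn01 b × (∀ n k → GTail b n k → k ≤ℕ b n)

Infinite : (ℕ → Set) → Set
Infinite Λ = ∀ m → ∃ λ n → (n ≥ m) × Λ n

WGAA : ℚ → (ℕ → Set) → (ℕ → ℕ) → (ℕ → ℕ) → Set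
WGAA t Λ a b = (∀ n → GTail b n (a n))
             × (∀ n → a n ≤ℕ b n)
             × (∀ n → Λ n → ⟦ b n ⟧ ≤ t * ⟦ a n ⟧)

FromWGAA : (ℕ → ℕ) → (ℕ → ℕ) → Set₁
FromWGAA a b = ∃ λ (t : ℚ) → (1ℚ ≤ t) × (∃ λ (Λ : ℕ → Set) → Infinite Λ × WGAA t Λ a b)

{-# OPTIONS --safe #-}
module Submission where

-- Write r_n = Σ_{i ≥ n} 1/b_i, so that r_n = 1/b_n + r_{n+1}, and a_n = G(r_n) means
-- 1/a_n < r_n ≤ 1/(a_n - 1). Hence (a_n) is nondecreasing; it is unbounded because j
-- consecutive blocks of terms, each summing to more than 1/a_i ≥ 1/a_N, sum to more than
-- j/a_N, while all partial sums are at most 1. Eliminating r_{n+1} gives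
--   1/a_{n+1} < 1/(a_n - 1) - 1/b_n   and   1/a_n < 1/b_n + 1/(a_{n+1} - 1).
-- If b_n ≤ T a_n, the first forces a_{n+1} > (1 + 1/(2T)) a_n as soon as a_n > 2T + 3.
-- If a_{n+1} > (1 + 1/K) a_n, the second forces b_n < (2K + 1) a_n as soon as a_n ≥ 2K.
-- Since a_n → ∞, infinitely many n in Λ (resp. infinitely many jumps) meet these bounds.

open import Data.List.Base using (_∷_; [])
open import Data.Product using (∃; _×_; _,_; proj₁; proj₂)
open import Relation.Binary.PropositionalEquality

-- This block precedes the import of Data.Rational, so its unqualified arithmetic is that of ℕ.
module _ where
  open import Data.Nat.Base
  open import Data.Nat.Properties
  open import Data.Nat.Tactic.RingSolver using (solve)

  2T+3≤p⇒[1+p][p+2T+1]<2p² : ∀ T p → 2 * T + 3 ≤ p → suc p * (p + 2 * T + 1) < 2 * (p * p)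
  2T+3≤p⇒[1+p][p+2T+1]<2p² T p 2T+3≤p = begin-strict
    suc p * (p + 2 * T + 1)                  ≡⟨ solve (T ∷ p ∷ []) ⟩
    p * p + ((2 * T + 2) * p + (2 * T + 1))  <⟨ +-monoʳ-< (p * p) (+-monoʳ-< ((2 * T + 2) * p) 2T+1<p) ⟩
    p * p + ((2 * T + 2) * p + p)            ≡⟨ solve (T ∷ p ∷ []) ⟩
    p * p + (2 * T + 3) * p                  ≤⟨ +-monoʳ-≤ (p * p) (*-monoˡ-≤ p 2T+3≤p) ⟩
    p * p + p * p                            ≡⟨ solve (p ∷ []) ⟩
    2 * (p * p)                              ∎
    where
    open ≤-Reasoning
    2T+1<p : 2 * T + 1 < p
    2T+1<p = <-≤-trans (+-monoʳ-< (2 * T) (s≤s (s≤s z≤n))) 2T+3≤p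

  b≤TA⇒jump : ∀ {T A b B} → 1 ≤ T → 2 * T + 3 < A → A ≤ b → b ≤ T * A →
                  (A ∸ 1) * (b + B) ≤ b * B → 2 * T * A + A < 2 * T * B
  b≤TA⇒jump {T} {suc p} {b} {B} 1≤T (s≤s 2T+3≤p) A≤b b≤TA gap
    with d , refl ← m≤n⇒∃[o]m+o≡n (<⇒≤ A≤b) = *-cancelˡ-< d _ _ (begin-strict
      d * (2 * T * suc p + suc p)              ≡⟨ solve (T ∷ p ∷ d ∷ []) ⟩
      2 * T * (p * d) + d * (p + 2 * T + 1)    <⟨ +-monoʳ-< (2 * T * (p * d)) d[p+2T+1]<2Tp² ⟩
      2 * T * (p * d) + 2 * T * (p * p)        ≡⟨ solve (T ∷ p ∷ d ∷ []) ⟩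
      2 * T * (p * (p + d))                    ≤⟨ *-monoʳ-≤ (2 * T) p[p+d]≤dB ⟩
      2 * T * (d * B)                          ≡⟨ solve (T ∷ d ∷ B ∷ []) ⟩
      d * (2 * T * B)                          ∎)
    where
    open ≤-Reasoning
    p[p+d]≤dB : p * (p + d) ≤ d * B
    p[p+d]≤dB = +-cancelʳ-≤ (p * B) _ _ (begin
      p * (p + d) + p * B  ≡⟨ solve (p ∷ d ∷ B ∷ []) ⟩
      p * (p + d + B)      ≤⟨ gap ⟩
      (p + d) * B          ≡⟨ solve (p ∷ d ∷ B ∷ []) ⟩
      d * B + p * B        ∎)
    d[p+2T+1]<2Tp² : d * (p + 2 * T + 1) < 2 * T * (p * p)
    d[p+2T+1]<2Tp² = begin-strict
      d * (p + 2 * T + 1)              ≤⟨ *-monoˡ-≤ (p + 2 * T + 1) (≤-trans (m≤n+m d p) b≤TA) ⟩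
      T * suc p * (p + 2 * T + 1)      ≡⟨ *-assoc T (suc p) _ ⟩
      T * (suc p * (p + 2 * T + 1))    <⟨ *-monoʳ-< T {{>-nonZero 1≤T}}
                                            (2T+3≤p⇒[1+p][p+2T+1]<2p² T p 2T+3≤p) ⟩
      T * (2 * (p * p))                ≡⟨ solve (T ∷ p ∷ []) ⟩
      2 * T * (p * p)                  ∎

  k*m+m<k*n⇒m<n : ∀ k {m n} → k * m + m < k * n → m < n
  k*m+m<k*n⇒m<n k {m} km+m<kn =
    ≰⇒> (λ n≤m → <⇒≱ km+m<kn (≤-trans (*-monoʳ-≤ k n≤m) (m≤m+n (k * m) m)))

  jump⇒b<[2K+1]A : ∀ {K A b B} → 2 * K ≤ A → K * A + A < K * B →
                   b * (B ∸ 1) < A * (b + (B ∸ 1)) → b < (2 * K + 1) * A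
  jump⇒b<[2K+1]A {K} {A} {b} {B} 2K≤A jump gap
    with d , refl ← m≤n⇒∃[o]m+o≡n (k*m+m<k*n⇒m<n K jump) = *-cancelˡ-< d _ _ (begin-strict
      d * b                      ≡⟨ *-comm d b ⟩
      b * d                      <⟨ bd<A[A+d] ⟩
      A * A + A * d              ≤⟨ +-monoˡ-≤ (A * d) (*-monoʳ-≤ A (<⇒≤ A<2Kd)) ⟩
      A * (2 * K * d) + A * d    ≡⟨ solve (K ∷ A ∷ d ∷ []) ⟩
      d * ((2 * K + 1) * A)      ∎)
    where
    open ≤-Reasoning
    bd<A[A+d] : b * d < A * A + A * d
    bd<A[A+d] = +-cancelˡ-< (A * b) _ _ (begin-strict
      A * b + b * d              ≡⟨ solve (A ∷ b ∷ d ∷ []) ⟩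
      b * (A + d)                <⟨ gap ⟩
      A * (b + (A + d))          ≡⟨ solve (A ∷ b ∷ d ∷ []) ⟩
      A * b + (A * A + A * d)    ∎)
    A<K[1+d] : A < K * suc d
    A<K[1+d] = +-cancelˡ-< (K * A) _ _ (begin-strict
      K * A + A                  <⟨ jump ⟩
      K * suc (A + d)            ≡⟨ solve (K ∷ A ∷ d ∷ []) ⟩
      K * A + K * suc d          ∎)
    A<2Kd : A < 2 * K * d
    A<2Kd = +-cancelˡ-< A _ _ (begin-strict
      A + A                      ≡⟨ solve (A ∷ []) ⟩
      2 * A                      <⟨ *-monoʳ-< 2 A<K[1+d] ⟩
      2 * (K * suc d)            ≡⟨ solve (K ∷ d ∷ []) ⟩
      2 * K + 2 * K * d          ≤⟨ +-monoˡ-≤ (2 * K * d) 2K≤A ⟩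
      A + 2 * K * d              ∎)

open import Data.Empty using (⊥-elim)
import Data.Integer.Base
open import Data.Integer.Base as ℤ using (-[1+_]; +≤+; +<+; -≤+)
import Data.Integer.Properties as ℤ
open import Data.Nat.Base as ℕ using (ℕ; zero; suc; z≤n; s≤s; _≥_; _∸_; _⊔_)
import Data.Nat.Coprimality as C
import Data.Nat.Properties as ℕ
open import Data.Rational hiding (_≥_; _⊔_)
open import Data.Rational.Properties
open import Data.Rational.Solver using (module +-*-Solver)
open import Data.Rational.Unnormalised.Base as ℚᵘ using (mkℚᵘ; *≡*) renaming (_≃_ to _≃ᵘ_)
import Data.Rational.Unnormalised.Properties as ℚᵘ
open import Function.Bundles using (_⇔_; mk⇔; Equivalence)
open import Relation.Nullary using (¬_)

open import Defs

Eventually : (ℕ → Set) → Set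
Eventually P = ∃ λ n₀ → ∀ {n} → n ≥ n₀ → P n

Infinite-mono : ∀ {P Q : ℕ → Set} → (∀ {n} → P n → Q n) → Infinite P → Infinite Q
Infinite-mono P⇒Q P-infinite m = let n , n≥m , Pn = P-infinite m in n , n≥m , P⇒Q Pn

Infinite-∩-Eventually : ∀ {P Q : ℕ → Set} → Infinite P → Eventually Q →
                        Infinite (λ n → P n × Q n)
Infinite-∩-Eventually P-infinite (n₀ , Q-from-n₀) m =
  let n , n≥m⊔n₀ , Pn = P-infinite (m ⊔ n₀)
  in n , ℕ.≤-trans (ℕ.m≤m⊔n m n₀) n≥m⊔n₀ ,
     Pn , Q-from-n₀ (ℕ.≤-trans (ℕ.m≤n⊔m m n₀) n≥m⊔n₀)

-- ℤ's `+_` is opened only here: elsewhere it would clash with sections `x +_` of ℚ addition.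
module _ where
  open Data.Integer.Base using (+_)

  ⟦⟧≡mkℚ : ∀ n → ⟦ n ⟧ ≡ mkℚ (+ n) 0 (C.sym (C.1-coprimeTo n))
  ⟦⟧≡mkℚ n = normalize-coprime (C.sym (C.1-coprimeTo n))

  toℚᵘ-⟦⟧ : ∀ n → toℚᵘ ⟦ n ⟧ ≃ᵘ mkℚᵘ (+ n) 0
  toℚᵘ-⟦⟧ n = ℚᵘ.≃-reflexive (cong toℚᵘ (⟦⟧≡mkℚ n))

  ⟦⟧-+ : ∀ m n → ⟦ m ℕ.+ n ⟧ ≡ ⟦ m ⟧ + ⟦ n ⟧
  ⟦⟧-+ m n = toℚᵘ-injective (begin
    toℚᵘ ⟦ m ℕ.+ n ⟧                 ≈⟨ toℚᵘ-⟦⟧ (m ℕ.+ n) ⟩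
    mkℚᵘ (+ (m ℕ.+ n)) 0              ≈⟨ *≡* (cong (ℤ._* + 1) +[m+n]≡) ⟩
    mkℚᵘ (+ m) 0 ℚᵘ.+ mkℚᵘ (+ n) 0    ≈⟨ ℚᵘ.+-cong (toℚᵘ-⟦⟧ m) (toℚᵘ-⟦⟧ n) ⟨
    toℚᵘ ⟦ m ⟧ ℚᵘ.+ toℚᵘ ⟦ n ⟧        ≈⟨ toℚᵘ-homo-+ ⟦ m ⟧ ⟦ n ⟧ ⟨
    toℚᵘ (⟦ m ⟧ + ⟦ n ⟧)              ∎)
    where
    open ℚᵘ.≃-Reasoning
    +[m+n]≡ : + (m ℕ.+ n) ≡ + m ℤ.* + 1 ℤ.+ + n ℤ.* + 1
    +[m+n]≡ = trans (ℤ.pos-+ m n) (sym (cong₂ ℤ._+_ (ℤ.*-identityʳ (+ m)) (ℤ.*-identityʳ (+ n))))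

  ⟦⟧-* : ∀ m n → ⟦ m ℕ.* n ⟧ ≡ ⟦ m ⟧ * ⟦ n ⟧
  ⟦⟧-* m n = toℚᵘ-injective (begin
    toℚᵘ ⟦ m ℕ.* n ⟧                 ≈⟨ toℚᵘ-⟦⟧ (m ℕ.* n) ⟩
    mkℚᵘ (+ (m ℕ.* n)) 0              ≈⟨ *≡* (cong (ℤ._* + 1) (ℤ.pos-* m n)) ⟩
    mkℚᵘ (+ m) 0 ℚᵘ.* mkℚᵘ (+ n) 0    ≈⟨ ℚᵘ.*-cong (toℚᵘ-⟦⟧ m) (toℚᵘ-⟦⟧ n) ⟨
    toℚᵘ ⟦ m ⟧ ℚᵘ.* toℚᵘ ⟦ n ⟧        ≈⟨ toℚᵘ-homo-* ⟦ m ⟧ ⟦ n ⟧ ⟨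
    toℚᵘ (⟦ m ⟧ * ⟦ n ⟧)              ∎)
    where open ℚᵘ.≃-Reasoning

  ⟦⟧-mono-≤ : ∀ {m n} → m ℕ.≤ n → ⟦ m ⟧ ≤ ⟦ n ⟧
  ⟦⟧-mono-≤ {m} {n} m≤n rewrite ⟦⟧≡mkℚ m | ⟦⟧≡mkℚ n = *≤* (ℤ.*-monoʳ-≤-nonNeg (+ 1) (+≤+ m≤n))

  ⟦⟧-cancel-≤ : ∀ {m n} → ⟦ m ⟧ ≤ ⟦ n ⟧ → m ℕ.≤ n
  ⟦⟧-cancel-≤ {m} {n} ⟦m⟧≤⟦n⟧ rewrite ⟦⟧≡mkℚ m | ⟦⟧≡mkℚ n =
    ℤ.drop‿+≤+ (ℤ.*-cancelʳ-≤-pos _ _ (+ 1) (drop-*≤* ⟦m⟧≤⟦n⟧))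

  ⟦⟧-mono-< : ∀ {m n} → m ℕ.< n → ⟦ m ⟧ < ⟦ n ⟧
  ⟦⟧-mono-< {m} {n} m<n rewrite ⟦⟧≡mkℚ m | ⟦⟧≡mkℚ n = *<* (ℤ.*-monoʳ-<-pos (+ 1) (+<+ m<n))

  ⟦⟧-cancel-< : ∀ {m n} → ⟦ m ⟧ < ⟦ n ⟧ → m ℕ.< n
  ⟦⟧-cancel-< {m} {n} ⟦m⟧<⟦n⟧ rewrite ⟦⟧≡mkℚ m | ⟦⟧≡mkℚ n =
    ℤ.drop‿+<+ (ℤ.*-cancelʳ-<-nonNeg (+ 1) (drop-*<* ⟦m⟧<⟦n⟧))

  ⟦⟧-nonNeg : ∀ n → NonNegative ⟦ n ⟧
  ⟦⟧-nonNeg n = normalize-nonNeg n 1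

  ⟦suc⟧-pos : ∀ n → Positive ⟦ suc n ⟧
  ⟦suc⟧-pos n = normalize-pos (suc n) 1

  recip-nonNeg : ∀ n → NonNegative (recip n)
  recip-nonNeg zero    = normalize-nonNeg 0 1
  recip-nonNeg (suc n) = normalize-nonNeg 1 (suc n)

  0<recip : ∀ {n} → 1 ℕ.≤ n → 0ℚ < recip n
  0<recip {suc n} _ = positive⁻¹ (recip (suc n)) {{normalize-pos 1 (suc n)}}

  recip≡mkℚ : ∀ n → recip (suc n) ≡ mkℚ (+ 1) n (C.1-coprimeTo (suc n))
  recip≡mkℚ n = normalize-coprime (C.1-coprimeTo (suc n))

  ⟦⟧-*-recip : ∀ {n} → 1 ℕ.≤ n → ⟦ n ⟧ * recip n ≡ 1ℚ
  ⟦⟧-*-recip {suc n} _ = trans (cong₂ _*_ (⟦⟧≡mkℚ (suc n)) (recip≡mkℚ n))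
    (*-inverseʳ (mkℚ (+ suc n) 0 (C.sym (C.1-coprimeTo (suc n)))))

  archimedean-recip : ∀ {ε} → 0ℚ < ε → ∃ λ k → recip (suc k) ≤ ε
  archimedean-recip {mkℚ (+ zero)  _ _} (*<* (+<+ ()))
  archimedean-recip {mkℚ -[1+ _ ]  _ _} (*<* ())
  archimedean-recip {ε@(mkℚ (+ suc n) d _)} _ =
    d , subst (_≤ ε) (sym (recip≡mkℚ d))
          (*≤* (ℤ.*-monoʳ-≤-nonNeg (+ suc d) {+ 1} {+ suc n} (+≤+ (s≤s z≤n))))

  archimedean-⟦⟧ : ∀ t → ∃ λ k → t ≤ ⟦ k ⟧
  archimedean-⟦⟧ (mkℚ -[1+ _ ] _ _) = 0 , *≤* -≤+
  archimedean-⟦⟧ t@(mkℚ (+ n)    d _) =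
    n , subst (t ≤_) (sym (⟦⟧≡mkℚ n))
          (*≤* (ℤ.*-monoˡ-≤-nonNeg (+ n) {+ 1} {+ suc d} (+≤+ (s≤s z≤n))))

recip[n]*[⟦n⟧*x]≡x : ∀ {n} → 1 ℕ.≤ n → ∀ x → recip n * (⟦ n ⟧ * x) ≡ x
recip[n]*[⟦n⟧*x]≡x {n} 1≤n x = begin
  recip n * (⟦ n ⟧ * x)  ≡⟨ *-assoc (recip n) ⟦ n ⟧ x ⟨
  recip n * ⟦ n ⟧ * x    ≡⟨ cong (_* x) (trans (*-comm (recip n) ⟦ n ⟧) (⟦⟧-*-recip 1≤n)) ⟩
  1ℚ * x                 ≡⟨ *-identityˡ x ⟩
  x                      ∎
  where open ≡-Reasoning

1≤⟦n⟧*x⇒recip≤x : ∀ {n x} → 1 ℕ.≤ n → 1ℚ ≤ ⟦ n ⟧ * x → recip n ≤ x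
1≤⟦n⟧*x⇒recip≤x {n} {x} 1≤n 1≤nx = begin
  recip n                ≡⟨ *-identityʳ (recip n) ⟨
  recip n * 1ℚ           ≤⟨ *-monoˡ-≤-nonNeg (recip n) {{recip-nonNeg n}} 1≤nx ⟩
  recip n * (⟦ n ⟧ * x)  ≡⟨ recip[n]*[⟦n⟧*x]≡x 1≤n x ⟩
  x                      ∎
  where open ≤-Reasoning

⟦n⟧*x≤1⇒x≤recip : ∀ {n x} → 1 ℕ.≤ n → ⟦ n ⟧ * x ≤ 1ℚ → x ≤ recip n
⟦n⟧*x≤1⇒x≤recip {n} {x} 1≤n nx≤1 = begin
  x                      ≡⟨ recip[n]*[⟦n⟧*x]≡x 1≤n x ⟨
  recip n * (⟦ n ⟧ * x)  ≤⟨ *-monoˡ-≤-nonNeg (recip n) {{recip-nonNeg n}} nx≤1 ⟩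
  recip n * 1ℚ           ≡⟨ *-identityʳ (recip n) ⟩
  recip n                ∎
  where open ≤-Reasoning

⟦⟧-*-recip-sum : ∀ u {v w} → 1 ℕ.≤ v → 1 ℕ.≤ w →
                 ⟦ v ℕ.* w ⟧ * (⟦ u ⟧ * (recip v + recip w)) ≡ ⟦ u ℕ.* (v ℕ.+ w) ⟧
⟦⟧-*-recip-sum u {v} {w} 1≤v 1≤w = begin
  ⟦ v ℕ.* w ⟧ * (⟦ u ⟧ * (recip v + recip w))
    ≡⟨ cong (_* (⟦ u ⟧ * (recip v + recip w))) (⟦⟧-* v w) ⟩
  ⟦ v ⟧ * ⟦ w ⟧ * (⟦ u ⟧ * (recip v + recip w))
    ≡⟨ ℚ-solve 5 (λ v w u r s → v :* w :* (u :* (r :+ s))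
                               := u :* (w :* (v :* r) :+ v :* (w :* s)))
               refl ⟦ v ⟧ ⟦ w ⟧ ⟦ u ⟧ (recip v) (recip w) ⟩
  ⟦ u ⟧ * (⟦ w ⟧ * (⟦ v ⟧ * recip v) + ⟦ v ⟧ * (⟦ w ⟧ * recip w))
    ≡⟨ cong₂ (λ r s → ⟦ u ⟧ * (⟦ w ⟧ * r + ⟦ v ⟧ * s)) (⟦⟧-*-recip 1≤v) (⟦⟧-*-recip 1≤w) ⟩
  ⟦ u ⟧ * (⟦ w ⟧ * 1ℚ + ⟦ v ⟧ * 1ℚ)
    ≡⟨ ℚ-solve 3 (λ u v w → u :* (w :* con 1ℚ :+ v :* con 1ℚ) := u :* (v :+ w))
               refl ⟦ u ⟧ ⟦ v ⟧ ⟦ w ⟧ ⟩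
  ⟦ u ⟧ * (⟦ v ⟧ + ⟦ w ⟧)
    ≡⟨ trans (⟦⟧-* u (v ℕ.+ w)) (cong (⟦ u ⟧ *_) (⟦⟧-+ v w)) ⟨
  ⟦ u ℕ.* (v ℕ.+ w) ⟧ ∎
  where
  open ≡-Reasoning
  open +-*-Solver using (_:+_; _:*_; _:=_; con) renaming (solve to ℚ-solve)

1<⟦u⟧*recip-sum⇒ : ∀ {u v w} → 1 ℕ.≤ v → 1 ℕ.≤ w →
                   1ℚ < ⟦ u ⟧ * (recip v + recip w) → v ℕ.* w ℕ.< u ℕ.* (v ℕ.+ w)
1<⟦u⟧*recip-sum⇒ {u} {v@(suc v-1)} {w@(suc w-1)} 1≤v 1≤w 1<X = ⟦⟧-cancel-< (begin-strict
  ⟦ v ℕ.* w ⟧                                   ≡⟨ *-identityʳ ⟦ v ℕ.* w ⟧ ⟨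
  ⟦ v ℕ.* w ⟧ * 1ℚ
    <⟨ *-monoʳ-<-pos ⟦ v ℕ.* w ⟧ {{⟦suc⟧-pos (w-1 ℕ.+ v-1 ℕ.* w)}} 1<X ⟩
  ⟦ v ℕ.* w ⟧ * (⟦ u ⟧ * (recip v + recip w))   ≡⟨ ⟦⟧-*-recip-sum u 1≤v 1≤w ⟩
  ⟦ u ℕ.* (v ℕ.+ w) ⟧                           ∎)
  where open ≤-Reasoning

⟦u⟧*recip-sum≤1⇒ : ∀ {u v w} → 1 ℕ.≤ v → 1 ℕ.≤ w →
                   ⟦ u ⟧ * (recip v + recip w) ≤ 1ℚ → u ℕ.* (v ℕ.+ w) ℕ.≤ v ℕ.* w
⟦u⟧*recip-sum≤1⇒ {u} {v} {w} 1≤v 1≤w X≤1 = ⟦⟧-cancel-≤ (begin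
  ⟦ u ℕ.* (v ℕ.+ w) ⟧                           ≡⟨ ⟦⟧-*-recip-sum u 1≤v 1≤w ⟨
  ⟦ v ℕ.* w ⟧ * (⟦ u ⟧ * (recip v + recip w))
    ≤⟨ *-monoˡ-≤-nonNeg ⟦ v ℕ.* w ⟧ {{⟦⟧-nonNeg (v ℕ.* w)}} X≤1 ⟩
  ⟦ v ℕ.* w ⟧ * 1ℚ                              ≡⟨ *-identityʳ ⟦ v ℕ.* w ⟧ ⟩
  ⟦ v ℕ.* w ⟧                                   ∎)
  where open ≤-Reasoning

jump⇔ : ∀ {k} → 1 ℕ.≤ k → ∀ A B → (1ℚ + recip k) * ⟦ A ⟧ < ⟦ B ⟧ ⇔ k ℕ.* A ℕ.+ A ℕ.< k ℕ.* B
jump⇔ {k@(suc k-1)} 1≤k A B = mk⇔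
  (λ jump → ⟦⟧-cancel-< (subst₂ _<_ scaled (sym (⟦⟧-* k B))
                          (*-monoʳ-<-pos ⟦ k ⟧ {{⟦suc⟧-pos k-1}} jump)))
  (λ jump → *-cancelˡ-<-nonNeg ⟦ k ⟧ {{⟦⟧-nonNeg k}}
              (subst₂ _<_ (sym scaled) (⟦⟧-* k B) (⟦⟧-mono-< jump)))
  where
  open +-*-Solver using (_:+_; _:*_; _:=_; con) renaming (solve to ℚ-solve)
  open ≡-Reasoning
  scaled : ⟦ k ⟧ * ((1ℚ + recip k) * ⟦ A ⟧) ≡ ⟦ k ℕ.* A ℕ.+ A ⟧
  scaled = begin
    ⟦ k ⟧ * ((1ℚ + recip k) * ⟦ A ⟧)
      ≡⟨ ℚ-solve 3 (λ k r a → k :* ((con 1ℚ :+ r) :* a) := k :* a :+ k :* r :* a)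
                 refl ⟦ k ⟧ (recip k) ⟦ A ⟧ ⟩
    ⟦ k ⟧ * ⟦ A ⟧ + ⟦ k ⟧ * recip k * ⟦ A ⟧
      ≡⟨ cong (λ r → ⟦ k ⟧ * ⟦ A ⟧ + r * ⟦ A ⟧) (⟦⟧-*-recip 1≤k) ⟩
    ⟦ k ⟧ * ⟦ A ⟧ + 1ℚ * ⟦ A ⟧
      ≡⟨ cong (λ x → ⟦ k ⟧ * ⟦ A ⟧ + x) (*-identityˡ ⟦ A ⟧) ⟩
    ⟦ k ⟧ * ⟦ A ⟧ + ⟦ A ⟧
      ≡⟨ trans (⟦⟧-+ (k ℕ.* A) A) (cong (_+ ⟦ A ⟧) (⟦⟧-* k A)) ⟨
    ⟦ k ℕ.* A ℕ.+ A ⟧ ∎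

1≮0 : ¬ 1ℚ < 0ℚ
1≮0 (*<* (+<+ ()))

module _ (b : ℕ → ℕ) where

  tailSum-nonNeg : ∀ n m → 0ℚ ≤ tailSum b n m
  tailSum-nonNeg n zero    = ≤-refl
  tailSum-nonNeg n (suc m) =
    +-mono-≤ (nonNegative⁻¹ (recip (b n)) {{recip-nonNeg (b n)}}) (tailSum-nonNeg (suc n) m)

  tailSum-drop-≤ : ∀ n m → tailSum b (suc n) m ≤ tailSum b n (suc m)
  tailSum-drop-≤ n m = begin
    tailSum b (suc n) m                ≡⟨ +-identityˡ _ ⟨
    0ℚ + tailSum b (suc n) m           ≤⟨ +-monoˡ-≤ _ (nonNegative⁻¹ (recip (b n)) {{recip-nonNeg (b n)}}) ⟩
    recip (b n) + tailSum b (suc n) m  ∎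
    where open ≤-Reasoning

  tailSum-+ : ∀ n m₁ m₂ → tailSum b n (m₁ ℕ.+ m₂) ≡ tailSum b n m₁ + tailSum b (n ℕ.+ m₁) m₂
  tailSum-+ n zero     m₂ = begin
    tailSum b n m₂               ≡⟨ cong (λ i → tailSum b i m₂) (ℕ.+-identityʳ n) ⟨
    tailSum b (n ℕ.+ 0) m₂       ≡⟨ +-identityˡ _ ⟨
    0ℚ + tailSum b (n ℕ.+ 0) m₂  ∎
    where open ≡-Reasoning
  tailSum-+ n (suc m₁) m₂ = begin
    recip (b n) + tailSum b (suc n) (m₁ ℕ.+ m₂)
      ≡⟨ cong (recip (b n) +_) (tailSum-+ (suc n) m₁ m₂) ⟩
    recip (b n) + (tailSum b (suc n) m₁ + tailSum b (suc n ℕ.+ m₁) m₂)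
      ≡⟨ +-assoc (recip (b n)) _ _ ⟨
    recip (b n) + tailSum b (suc n) m₁ + tailSum b (suc n ℕ.+ m₁) m₂
      ≡⟨ cong (λ i → recip (b n) + tailSum b (suc n) m₁ + tailSum b i m₂) (ℕ.+-suc n m₁) ⟨
    recip (b n) + tailSum b (suc n) m₁ + tailSum b (n ℕ.+ suc m₁) m₂  ∎
    where open ≡-Reasoning

  GTail⇒1≤ : ∀ {n k} → GTail b n k → 1 ℕ.≤ k
  GTail⇒1≤ {k = zero}  ((m , 1<0*T) , _) =
    ⊥-elim (1≮0 (subst (1ℚ <_) (*-zeroˡ (tailSum b _ m)) 1<0*T))
  GTail⇒1≤ {k = suc _} _                  = s≤s z≤n

  GTail-mono : ∀ {n k k′} → GTail b n k → GTail b (suc n) k′ → k ℕ.≤ k′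
  GTail-mono {n} {k} {k′} (_ , upper) ((m , lower) , _) =
    ℕ.≮⇒≥ λ k′<k → <-irrefl refl (begin-strict
    1ℚ                               <⟨ lower ⟩
    ⟦ k′ ⟧ * tailSum b (suc n) m     ≤⟨ *-monoʳ-≤-nonNeg _ {{nonNegative (tailSum-nonNeg (suc n) m)}}
                                          (⟦⟧-mono-≤ (ℕ.<⇒≤pred k′<k)) ⟩
    ⟦ k ∸ 1 ⟧ * tailSum b (suc n) m  ≤⟨ *-monoˡ-≤-nonNeg ⟦ k ∸ 1 ⟧ {{⟦⟧-nonNeg (k ∸ 1)}}
                                          (tailSum-drop-≤ n m) ⟩
    ⟦ k ∸ 1 ⟧ * tailSum b n (suc m)  ≤⟨ upper (suc m) ⟩
    1ℚ                               ∎)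
    where open ≤-Reasoning

  GTail-gap-upper : ∀ {n k k′} → GTail b n k → GTail b (suc n) k′ →
                    ⟦ k ∸ 1 ⟧ * (recip (b n) + recip k′) ≤ 1ℚ
  GTail-gap-upper {n} {k} {k′} (_ , upper) Gk′@((m , lower) , _) = begin
    ⟦ k ∸ 1 ⟧ * (recip (b n) + recip k′)
      ≤⟨ *-monoˡ-≤-nonNeg ⟦ k ∸ 1 ⟧ {{⟦⟧-nonNeg (k ∸ 1)}} (+-monoʳ-≤ (recip (b n)) 1/k′≤T) ⟩
    ⟦ k ∸ 1 ⟧ * (recip (b n) + tailSum b (suc n) m)
      ≤⟨ upper (suc m) ⟩
    1ℚ ∎
    where
    open ≤-Reasoning
    1/k′≤T : recip k′ ≤ tailSum b (suc n) m
    1/k′≤T = 1≤⟦n⟧*x⇒recip≤x {k′} (GTail⇒1≤ Gk′) (<⇒≤ lower)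

  GTail-gap-lower : ∀ {n k k′} → GTail b n k → GTail b (suc n) k′ → 1 ℕ.≤ k′ ∸ 1 →
                    1ℚ < ⟦ k ⟧ * (recip (b n) + recip (k′ ∸ 1))
  GTail-gap-lower {n} {k} {k′} ((zero , 1<k*0) , _) _ _ =
    ⊥-elim (1≮0 (subst (1ℚ <_) (*-zeroʳ ⟦ k ⟧) 1<k*0))
  GTail-gap-lower {n} {k} {k′} ((suc m , lower) , _) (_ , upper) 1≤k′-1 = begin-strict
    1ℚ
      <⟨ lower ⟩
    ⟦ k ⟧ * (recip (b n) + tailSum b (suc n) m)
      ≤⟨ *-monoˡ-≤-nonNeg ⟦ k ⟧ {{⟦⟧-nonNeg k}} (+-monoʳ-≤ (recip (b n)) T≤1/[k′-1]) ⟩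
    ⟦ k ⟧ * (recip (b n) + recip (k′ ∸ 1)) ∎
    where
    open ≤-Reasoning
    T≤1/[k′-1] : tailSum b (suc n) m ≤ recip (k′ ∸ 1)
    T≤1/[k′-1] = ⟦n⟧*x≤1⇒x≤recip 1≤k′-1 (upper m)

module _ {b a : ℕ → ℕ} (Ga : ∀ n → GTail b n (a n)) where

  a-mono : ∀ {m n} → m ℕ.≤ n → a m ℕ.≤ a n
  a-mono m≤n = go (ℕ.≤⇒≤′ m≤n)
    where
    go : ∀ {m n} → m ℕ.≤′ n → a m ℕ.≤ a n
    go ℕ.≤′-refl        = ℕ.≤-refl
    go (ℕ.≤′-step m≤′n) = ℕ.≤-trans (go m≤′n) (GTail-mono b (Ga _) (Ga _))

  ⟦j⟧≤⟦a⟧*tailSum : ∀ j n → ∃ λ m → ⟦ j ⟧ ≤ ⟦ a (n ℕ.+ m) ⟧ * tailSum b n m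
  ⟦j⟧≤⟦a⟧*tailSum zero    n = 0 , ≤-reflexive (sym (*-zeroʳ ⟦ a (n ℕ.+ 0) ⟧))
  ⟦j⟧≤⟦a⟧*tailSum (suc j) n =
    let m₁ , 1<a*T₁ = proj₁ (Ga n) in step m₁ 1<a*T₁ (⟦j⟧≤⟦a⟧*tailSum j (n ℕ.+ m₁))
    where
    step : ∀ m₁ → 1ℚ < ⟦ a n ⟧ * tailSum b n m₁ →
           (∃ λ m₂ → ⟦ j ⟧ ≤ ⟦ a (n ℕ.+ m₁ ℕ.+ m₂) ⟧ * tailSum b (n ℕ.+ m₁) m₂) →
           ∃ λ m → ⟦ suc j ⟧ ≤ ⟦ a (n ℕ.+ m) ⟧ * tailSum b n m
    step m₁ 1<a*T₁ (m₂ , j≤a*T₂) = m₁ ℕ.+ m₂ , (begin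
      ⟦ 1 ℕ.+ j ⟧                 ≡⟨ ⟦⟧-+ 1 j ⟩
      1ℚ + ⟦ j ⟧                  ≤⟨ +-mono-≤ (<⇒≤ 1<a*T₁) j≤a*T₂ ⟩
      ⟦ a n ⟧ * T₁ + ⟦ a (n ℕ.+ m₁ ℕ.+ m₂) ⟧ * T₂
        ≤⟨ +-monoˡ-≤ _ (*-monoʳ-≤-nonNeg T₁ {{nonNegative (tailSum-nonNeg b n m₁)}}
                                          (⟦⟧-mono-≤ (a-mono n≤N))) ⟩
      ⟦ a N ⟧ * T₁ + ⟦ a (n ℕ.+ m₁ ℕ.+ m₂) ⟧ * T₂
        ≡⟨ cong (λ i → ⟦ a N ⟧ * T₁ + ⟦ a i ⟧ * T₂) (ℕ.+-assoc n m₁ m₂) ⟩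
      ⟦ a N ⟧ * T₁ + ⟦ a N ⟧ * T₂ ≡⟨ *-distribˡ-+ ⟦ a N ⟧ T₁ T₂ ⟨
      ⟦ a N ⟧ * (T₁ + T₂)         ≡⟨ cong (⟦ a N ⟧ *_) (tailSum-+ b n m₁ m₂) ⟨
      ⟦ a N ⟧ * tailSum b n (m₁ ℕ.+ m₂) ∎)
      where
      open ≤-Reasoning
      N : ℕ
      N = n ℕ.+ (m₁ ℕ.+ m₂)
      T₁ T₂ : ℚ
      T₁ = tailSum b n m₁
      T₂ = tailSum b (n ℕ.+ m₁) m₂
      n≤N : n ℕ.≤ N
      n≤N = ℕ.m≤m+n n (m₁ ℕ.+ m₂)

  a-unbounded : (∀ m → partialSum b m ≤ 1ℚ) → ∀ M → ∃ λ n → M ℕ.< a n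
  a-unbounded partialSum≤1 M =
    let m , M+1≤a*S = ⟦j⟧≤⟦a⟧*tailSum (suc M) 0 in m , ⟦⟧-cancel-≤ (begin
    ⟦ suc M ⟧                 ≤⟨ M+1≤a*S ⟩
    ⟦ a m ⟧ * partialSum b m  ≤⟨ *-monoˡ-≤-nonNeg ⟦ a m ⟧ {{⟦⟧-nonNeg (a m)}} (partialSum≤1 m) ⟩
    ⟦ a m ⟧ * 1ℚ              ≡⟨ *-identityʳ ⟦ a m ⟧ ⟩
    ⟦ a m ⟧                   ∎)
    where open ≤-Reasoning

  a-eventually-≥ : (∀ m → partialSum b m ≤ 1ℚ) → ∀ M → Eventually (λ n → M ℕ.≤ a n)
  a-eventually-≥ partialSum≤1 M =
    let n₀ , M<a = a-unbounded partialSum≤1 M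
    in n₀ , λ n≥n₀ → ℕ.≤-trans (ℕ.<⇒≤ M<a) (a-mono n≥n₀)

Jump : ℚ → (ℕ → ℕ) → ℕ → Set
Jump ε a n = (1ℚ + ε) * ⟦ a n ⟧ < ⟦ a (suc n) ⟧

module _ {b a : ℕ → ℕ} (wg : WeakGreedy b) (Ga : ∀ n → GTail b n (a n)) where

  private
    1≤b : ∀ n → 1 ℕ.≤ b n
    1≤b = proj₁ (proj₁ wg)

    a-large : ∀ M → Eventually (λ n → M ℕ.≤ a n)
    a-large = a-eventually-≥ Ga (proj₂ (proj₁ wg))

    gap-upper : ∀ n → (a n ∸ 1) ℕ.* (b n ℕ.+ a (suc n)) ℕ.≤ b n ℕ.* a (suc n)
    gap-upper n = ⟦u⟧*recip-sum≤1⇒ {a n ∸ 1} (1≤b n) (GTail⇒1≤ b (Ga (suc n)))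
      (GTail-gap-upper b {n} {a n} {a (suc n)} (Ga n) (Ga (suc n)))

    gap-lower : ∀ n → 1 ℕ.≤ a (suc n) ∸ 1 →
                b n ℕ.* (a (suc n) ∸ 1) ℕ.< a n ℕ.* (b n ℕ.+ (a (suc n) ∸ 1))
    gap-lower n 1≤a′-1 = 1<⟦u⟧*recip-sum⇒ {a n} (1≤b n) 1≤a′-1
      (GTail-gap-lower b {n} {a n} {a (suc n)} (Ga n) (Ga (suc n)) 1≤a′-1)

  fromWGAA⇒jumps : FromWGAA a b → ∃ λ ε → (0ℚ < ε) × Infinite (Jump ε a)
  fromWGAA⇒jumps (t , _ , Λ , Λ-infinite , _ , a≤b , b≤ta) =
    recip (2 ℕ.* T) , 0<recip 1≤2T ,
    Infinite-mono jump-at (Infinite-∩-Eventually Λ-infinite (a-large (suc (2 ℕ.* T ℕ.+ 3))))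
    where
    T : ℕ
    T = suc (proj₁ (archimedean-⟦⟧ t))
    1≤2T : 1 ℕ.≤ 2 ℕ.* T
    1≤2T = s≤s z≤n
    t≤T : t ≤ ⟦ T ⟧
    t≤T = ≤-trans (proj₂ (archimedean-⟦⟧ t)) (⟦⟧-mono-≤ (ℕ.n≤1+n (proj₁ (archimedean-⟦⟧ t))))
    b≤Ta : ∀ {n} → Λ n → b n ℕ.≤ T ℕ.* a n
    b≤Ta {n} Λn = ⟦⟧-cancel-≤ (begin
      ⟦ b n ⟧          ≤⟨ b≤ta n Λn ⟩
      t * ⟦ a n ⟧      ≤⟨ *-monoʳ-≤-nonNeg ⟦ a n ⟧ {{⟦⟧-nonNeg (a n)}} t≤T ⟩
      ⟦ T ⟧ * ⟦ a n ⟧  ≡⟨ ⟦⟧-* T (a n) ⟨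
      ⟦ T ℕ.* a n ⟧    ∎)
      where open ≤-Reasoning
    jump-at : ∀ {n} → Λ n × 2 ℕ.* T ℕ.+ 3 ℕ.< a n → Jump (recip (2 ℕ.* T)) a n
    jump-at {n} (Λn , 2T+3<a) = Equivalence.from (jump⇔ 1≤2T (a n) (a (suc n)))
      (b≤TA⇒jump (s≤s z≤n) 2T+3<a (a≤b n) (b≤Ta Λn) (gap-upper n))

  jumps⇒fromWGAA : (∃ λ ε → (0ℚ < ε) × Infinite (Jump ε a)) → FromWGAA a b
  jumps⇒fromWGAA (ε , 0<ε , jumps) =
    t , ⟦⟧-mono-≤ {1} {2 ℕ.* K ℕ.+ 1} (s≤s z≤n) , Λ ,
    Infinite-mono Λ-at (Infinite-∩-Eventually jumps (a-large (2 ℕ.* K))) ,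
    Ga , (λ n → proj₂ wg n (a n) (Ga n)) , (λ _ Λn → Λn)
    where
    K : ℕ
    K = suc (proj₁ (archimedean-recip 0<ε))
    t : ℚ
    t = ⟦ 2 ℕ.* K ℕ.+ 1 ⟧
    Λ : ℕ → Set
    Λ n = ⟦ b n ⟧ ≤ t * ⟦ a n ⟧
    Ka+a<Ka′ : ∀ {n} → Jump ε a n → K ℕ.* a n ℕ.+ a n ℕ.< K ℕ.* a (suc n)
    Ka+a<Ka′ {n} jump = Equivalence.to (jump⇔ {K} (s≤s z≤n) (a n) (a (suc n))) (≤-<-trans
      (*-monoʳ-≤-nonNeg ⟦ a n ⟧ {{⟦⟧-nonNeg (a n)}} (+-monoʳ-≤ 1ℚ (proj₂ (archimedean-recip 0<ε))))
      jump)
    Λ-at : ∀ {n} → Jump ε a n × 2 ℕ.* K ℕ.≤ a n → Λ n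
    Λ-at {n} (jump , 2K≤a) =
      subst (⟦ b n ⟧ ≤_) (⟦⟧-* (2 ℕ.* K ℕ.+ 1) (a n)) (⟦⟧-mono-≤ (ℕ.<⇒≤ b<ta))
      where
      1≤a′-1 : 1 ℕ.≤ a (suc n) ∸ 1
      1≤a′-1 = ℕ.≤-trans (ℕ.≤-trans (s≤s z≤n) 2K≤a) (ℕ.<⇒≤pred (k*m+m<k*n⇒m<n K (Ka+a<Ka′ jump)))
      b<ta : b n ℕ.< (2 ℕ.* K ℕ.+ 1) ℕ.* a n
      b<ta = jump⇒b<[2K+1]A 2K≤a (Ka+a<Ka′ jump) (gap-lower n 1≤a′-1)

corollary1 : (b a : ℕ → ℕ) → WeakGreedy b → (∀ n → GTail b n (a n))
    → FromWGAA a b ⇔ (∃ λ (ε : ℚ) → (0ℚ < ε) × (∀ m → ∃ λ n → (n ≥ m) × ((1ℚ + ε) * ⟦ a n ⟧ < ⟦ a (suc n) ⟧)))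
corollary1 b a wg Ga = mk⇔ (fromWGAA⇒jumps wg Ga) (jumps⇒fromWGAA wg Ga)
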